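{- Let $t$ be a join node with children $t_1,t_2$ (so $X_t=X_{t_1}=X_{t_2}$ and $P_t=P_{t_1}=P_{t_2}$). Let $Q_1,Q_2\subseteq P_t$, let $\mathcal{S}$ be a $k$-tuple of subsets of $X_t$, and let $\hat{\mathcal{S}}=(\hat S_1,\ldots,\hat S_k)$ be a $k$-tuple of subsets of $V_t$ with $\hat S_i\cap X_t=S_i$ for all $i$. For $r\in\{1,2\}$ let $\hat{\mathcal{S}}_r=(\hat S_1\cap V_{t_r},\ldots,\hat S_k\cap V_{t_r})$, and let $\hat D=D[V_t]\oplus\hat{\mathcal{S}}$, $\hat D_r=D[V_{t_r}]\oplus\hat{\mathcal{S}}_r$. Assume that for every $(u,v)\in P_t$ and each $r\in\{1,2\}$, $\hat D_r$ contains a directed path from $u$ to $v$ if and only if $(u,v)\in Q_r$. Then for every $(u,v)\in P_t$, $\hat D$ contains a directed path from $u$ to $v$ if and only if $(u,v)$ belongs to the transitive closure of $Q_1\cup Q_2$ (i.e. $(u,v)$ is an arc of the digraph $B_{t,Q_1,Q_2}$ on vertex set $X_t$ whose arc set is this transitive closure).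
   Context: Inversion: for an oriented graph $D$ and a tuple $(Y_1,\ldots,Y_k)$ of vertex subsets, $D\oplus(Y_1,\ldots,Y_k)$ is obtained by successively reversing every arc with both endpoints in $Y_1$, then $Y_2$, etc.; sets may contain vertices outside the digraph, which cause no changes. Setting: $D$ is an oriented graph and $(T,\{X_t\})$ is a nice tree decomposition of its underlying undirected graph; for a node $t$, $V_t$ is the union of the bags of the subtree rooted at $t$, and $P_t$ is the set of ordered pairs of distinct vertices of $X_t$. A join node $t$ has exactly two children $t_1,t_2$ with $X_t=X_{t_1}=X_{t_2}$. The transitive closure of a binary relation $R$ is the smallest transitive relation containing $R$. -}

module Defs where

open import Level using (0ℓ)
open import Data.Bool using (Bool; true; false; if_then_else_; _∧_)
open import Data.Nat using (ℕ)
open import Data.Fin using (Fin)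
open import Data.Fin.Subset using (Subset; _∈_; _∉_; _∪_; _∩_; ⁅_⁆; ⊥)
open import Data.Vec using (Vec; []; _∷_; lookup; map)
open import Data.List using (List; []; _∷_; _++_)
open import Data.List.Membership.Propositional using () renaming (_∈_ to _∈ₗ_)
open import Data.List.Relation.Unary.Unique.Propositional using (Unique)
open import Data.Product using (Σ; ∃; _×_; _,_)
open import Data.Sum using (_⊎_)
open import Data.Unit using (⊤)
open import Data.Empty renaming (⊥ to Empty)
open import Relation.Binary.Core using (Rel)
open import Relation.Binary.PropositionalEquality using (_≡_; _≢_)

-- A digraph: a vertex set (subset of Fin n) and an arc relation.
-- Only arcs between vertices of vtx are meaningful (paths must stay in vtx).
record Digraph (n : ℕ) : Set where
  field
    vtx : Subset n
    arc : Fin n → Fin n → Bool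
open Digraph public

record OrientedGraph (n : ℕ) : Set where
  field
    arcO  : Fin n → Fin n → Bool
    irrefl : ∀ u → arcO u u ≡ false
    asym   : ∀ u v → arcO u v ≡ true → arcO v u ≡ false
open OrientedGraph public

_[_] : ∀ {n} → OrientedGraph n → Subset n → Digraph n
D [ W ] = record { vtx = W ; arc = arcO D }

invert : ∀ {n} → Digraph n → Subset n → Digraph n
invert G Y = record
  { vtx = vtx G
  ; arc = λ u v → if lookup Y u ∧ lookup Y v then arc G v u else arc G u v }

_⊕_ : ∀ {n k} → Digraph n → Vec (Subset n) k → Digraph n
G ⊕ []       = G
G ⊕ (Y ∷ Ys) = invert G Y ⊕ Ys

data Walk {n} (G : Digraph n) : Fin n → Fin n → List (Fin n) → Set where
  stop : ∀ {u} → u ∈ vtx G → Walk G u u (u ∷ [])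
  step : ∀ {u w v vs} → u ∈ vtx G → arc G u w ≡ true →
         Walk G w v vs → Walk G u v (u ∷ vs)

DirPath : ∀ {n} → Digraph n → Fin n → Fin n → Set
DirPath G u v = Σ (List _) λ vs → Walk G u v vs × Unique vs

data Tree (n : ℕ) : Set where
  node : Subset n → List (Tree n) → Tree n

bag : ∀ {n} → Tree n → Subset n
bag (node X _) = X

mutual
  Vt : ∀ {n} → Tree n → Subset n
  Vt (node X cs) = X ∪ Vts cs

  Vts : ∀ {n} → List (Tree n) → Subset n
  Vts []       = ⊥
  Vts (c ∷ cs) = Vt c ∪ Vts cs

-- s ≼ T : s is a node (the subtree rooted at a node) of T
data _≼_ {n} : Tree n → Tree n → Set where
  here  : ∀ {t} → t ≼ t
  below : ∀ {t c X cs} → c ∈ₗ cs → t ≼ c → t ≼ node X cs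

children : ∀ {n} → Tree n → List (Tree n)
children (node _ cs) = cs

-- Connectivity of {s | v ∈ bag s} is expressed by the (equivalent for
-- rooted trees) local conditions on parent/child and sibling pairs.
record IsTreeDecomposition {n} (D : OrientedGraph n) (T : Tree n) : Set where
  field
    vertexCover : ∀ v → ∃ λ s → s ≼ T × v ∈ bag s
    edgeCover   : ∀ u v → arcO D u v ≡ true →
                  ∃ λ s → s ≼ T × u ∈ bag s × v ∈ bag s
    connParent  : ∀ X cs c v → node X cs ≼ T → c ∈ₗ cs →
                  v ∈ X → v ∈ Vt c → v ∈ bag c
    connSibling : ∀ X cs₁ c₁ cs₂ c₂ cs₃ v →
                  node X (cs₁ ++ (c₁ ∷ (cs₂ ++ (c₂ ∷ cs₃)))) ≼ T →
                  v ∈ Vt c₁ → v ∈ Vt c₂ → v ∈ X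

-- Node types of a nice tree decomposition (leaf bags left unconstrained)
NiceNode : ∀ {n} → Tree n → Set
NiceNode (node X [])                = ⊤
NiceNode (node X (c ∷ []))          =
  (∃ λ v → v ∉ bag c × X ≡ bag c ∪ ⁅ v ⁆)
  ⊎ (∃ λ v → v ∉ X × bag c ≡ X ∪ ⁅ v ⁆)
NiceNode (node X (c₁ ∷ c₂ ∷ []))    = bag c₁ ≡ X × bag c₂ ≡ X
NiceNode (node X (_ ∷ _ ∷ _ ∷ _))   = Empty

record IsNiceTreeDecomposition {n} (D : OrientedGraph n) (T : Tree n) : Set where
  field
    isTD : IsTreeDecomposition D T
    nice : ∀ s → s ≼ T → NiceNode s

InP : ∀ {n} → Subset n → Fin n → Fin n → Set
InP X u v = u ∈ X × v ∈ X × u ≢ v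

_⊆P_ : ∀ {n} → Rel (Fin n) 0ℓ → Subset n → Set
Q ⊆P X = ∀ u v → Q u v → InP X u v

{-# OPTIONS --safe #-}
module Submission where

-- Every arc of D lies in a bag, and the bag X of the join node separates V_{t₁} ∖ X
-- from V_{t₂} ∖ X in the tree decomposition; moreover V_{t₁} ∩ V_{t₂} ⊆ X.  So a walk
-- of D̂ between two vertices of X, cut at its visits to X, falls into pieces each of
-- which stays inside a single V_{t_r}.  Inside V_{t_r} the inversion by Ŝ and by
-- Ŝ ∩ V_{t_r} reverse the same arcs, so each piece is a walk of D̂_r between vertices
-- of X, i.e. a pair of Q_r or a trivial piece.  Conversely, paths of D̂_r are walks of D̂.

open import Defs
open import Level using (0ℓ)
open import Data.Nat using (ℕ)
open import Data.Fin using (Fin; zero; suc; _≟_)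
open import Data.Fin.Subset using (Subset; _⊆_; _∩_; _∈_)
open import Data.Fin.Subset.Properties using (p⊆p∪q; q⊆p∪q; x∈p∪q⁻; ∉⊥)
open import Data.Vec using (Vec; []; _∷_; lookup; map)
open import Data.Vec.Properties using (lookup-zipWith; []=⇒lookup)
open import Data.List using (List; []; _∷_; _++_)
open import Data.List.Membership.Propositional using () renaming (_∈_ to _∈ₗ_)
open import Data.List.Membership.Propositional.Properties using (∈-∃++)
open import Data.List.Relation.Unary.Any using (here; there)
open import Data.List.Relation.Unary.All using ([])
open import Data.List.Relation.Unary.All.Properties using (¬Any⇒All¬)
open import Data.List.Relation.Unary.AllPairs using ([]; _∷_)
open import Data.List.Relation.Unary.Unique.Propositional using (Unique)
open import Data.Bool using (true; false; _∧_)
open import Data.Bool.Properties using (∧-identityʳ)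
open import Data.Product using (∃; _×_; _,_; proj₂)
open import Data.Sum using (_⊎_; inj₁; inj₂; swap)
open import Data.Empty using (⊥-elim)
open import Function using (id; _∘_)
open import Function.Bundles using (_⇔_; mk⇔; Equivalence)
open import Function.Properties.Equivalence using () renaming (sym to ⇔-sym; trans to ⇔-trans)
open import Relation.Nullary using (yes; no)
open import Relation.Binary.Core using (Rel; _⇒_)
open import Relation.Binary.Definitions using (Transitive)
open import Relation.Binary.PropositionalEquality using (_≡_; _≢_; refl; sym; trans; subst)
open import Relation.Binary.Construct.Union using (_∪_)
open import Relation.Binary.Construct.Closure.Transitive as TC using (TransClosure; _∷_)
open import Relation.Binary.Construct.Closure.ReflexiveTransitive using (Star; ε; _◅_; _⋆)
import Data.List.Membership.DecPropositional as DecMembership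

∈-order : ∀ {A : Set} {c d : A} {ds : List A} → c ∈ₗ ds → d ∈ₗ ds →
  c ≡ d ⊎ (∃ λ cs₁ → ∃ λ cs₂ → ∃ λ cs₃ → ds ≡ cs₁ ++ c ∷ cs₂ ++ d ∷ cs₃)
        ⊎ (∃ λ cs₁ → ∃ λ cs₂ → ∃ λ cs₃ → ds ≡ cs₁ ++ d ∷ cs₂ ++ c ∷ cs₃)
∈-order (here refl) (here refl) = inj₁ refl
∈-order (here refl) (there j) with ∈-∃++ j
... | cs₂ , cs₃ , refl = inj₂ (inj₁ ([] , cs₂ , cs₃ , refl))
∈-order (there i) (here refl) with ∈-∃++ i
... | cs₂ , cs₃ , refl = inj₂ (inj₂ ([] , cs₂ , cs₃ , refl))
∈-order {ds = x ∷ _} (there i) (there j) with ∈-order i j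
... | inj₁ c≡d = inj₁ c≡d
... | inj₂ (inj₁ (cs₁ , cs₂ , cs₃ , refl)) = inj₂ (inj₁ (x ∷ cs₁ , cs₂ , cs₃ , refl))
... | inj₂ (inj₂ (cs₁ , cs₂ , cs₃ , refl)) = inj₂ (inj₂ (x ∷ cs₁ , cs₂ , cs₃ , refl))

module _ {A : Set} {R : Rel A 0ℓ} where

  ◅⇒⁺ : ∀ {x y z} → R x y → Star R y z → TransClosure R x z
  ◅⇒⁺ r ε        = TC.[ r ]
  ◅⇒⁺ r (s ◅ rs) = r ∷ ◅⇒⁺ s rs

  star⇒⁺ : ∀ {x y} → Star R x y → x ≢ y → TransClosure R x y
  star⇒⁺ ε        x≢x = ⊥-elim (x≢x refl)
  star⇒⁺ (r ◅ rs) _   = ◅⇒⁺ r rs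

  fold⁺ : ∀ {P : Rel A 0ℓ} → Transitive P → R ⇒ P → TransClosure R ⇒ P
  fold⁺ _       R⇒P TC.[ r ] = R⇒P r
  fold⁺ P-trans R⇒P (r ∷ rs)  = P-trans (R⇒P r) (fold⁺ P-trans R⇒P rs)

module _ {n : ℕ} where

  ≼-trans : {r s t : Tree n} → r ≼ s → s ≼ t → r ≼ t
  ≼-trans r≼s here          = r≼s
  ≼-trans r≼s (below i s≼c) = below i (≼-trans r≼s s≼c)

  child-≼ : ∀ {c : Tree n} {X cs} → c ∈ₗ cs → c ≼ node X cs
  child-≼ i = below i here

  Vt-child⊆Vts : ∀ {c : Tree n} {cs} → c ∈ₗ cs → Vt c ⊆ Vts cs
  Vt-child⊆Vts {cs = c ∷ cs}  (here refl) = p⊆p∪q (Vts cs)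
  Vt-child⊆Vts {cs = c′ ∷ cs} (there i)   = q⊆p∪q (Vt c′) (Vts cs) ∘ Vt-child⊆Vts i

  Vt-mono : {s t : Tree n} → s ≼ t → Vt s ⊆ Vt t
  Vt-mono here                       = id
  Vt-mono (below {X = X} {cs} i s≼c) = q⊆p∪q X (Vts cs) ∘ Vt-child⊆Vts i ∘ Vt-mono s≼c

  bag⊆Vt : (s : Tree n) → bag s ⊆ Vt s
  bag⊆Vt (node X cs) = p⊆p∪q (Vts cs)

module TreeDecomposition {n} {D : OrientedGraph n} {T : Tree n}
                         (td : IsTreeDecomposition D T) where
  open IsTreeDecomposition td

  ∈bag-descends : ∀ {R p : Tree n} {v} → R ≼ T → p ≼ R → v ∈ bag R → v ∈ Vt p → v ∈ bag p
  ∈bag-descends R≼T here v∈R _ = v∈R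
  ∈bag-descends {node Y ds} R≼T (below {c = d} i p≼d) v∈R v∈p =
    ∈bag-descends (≼-trans (child-≼ i) R≼T) p≼d
      (connParent Y ds d _ R≼T i v∈R (Vt-mono p≼d v∈p)) v∈p

  ∈Vt-siblings : ∀ {Y ds c d v} → node Y ds ≼ T → c ∈ₗ ds → d ∈ₗ ds →
                 v ∈ Vt c → v ∈ Vt d → c ≡ d ⊎ v ∈ Y
  ∈Vt-siblings {Y} {v = v} p≼T i j v∈c v∈d with ∈-order i j
  ... | inj₁ c≡d = inj₁ c≡d
  ... | inj₂ (inj₁ (cs₁ , cs₂ , cs₃ , refl)) = inj₂ (connSibling Y cs₁ _ cs₂ _ cs₃ v p≼T v∈c v∈d)
  ... | inj₂ (inj₂ (cs₁ , cs₂ , cs₃ , refl)) = inj₂ (connSibling Y cs₁ _ cs₂ _ cs₃ v p≼T v∈d v∈c)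

  -- Stated inside an arbitrary subtree R ≼ T so that it can be proved by descending into R.
  ≼child⊎∈bag : ∀ {R p s c : Tree n} {v} → R ≼ T → p ≼ R → s ≼ R → c ∈ₗ children p →
                v ∈ bag s → v ∈ Vt c → s ≼ c ⊎ v ∈ bag p
  ≼child⊎∈bag R≼T here here _ v∈s _ = inj₂ v∈s
  ≼child⊎∈bag {p = node X cs} {s} R≼T here (below j s≼d) c∈p v∈s v∈c
    with ∈Vt-siblings R≼T c∈p j v∈c (Vt-mono s≼d (bag⊆Vt s v∈s))
  ... | inj₁ refl = inj₁ s≼d
  ... | inj₂ v∈X  = inj₂ v∈X
  ≼child⊎∈bag {p = node X cs} R≼T (below i p≼d) here c∈p v∈s v∈c =
    inj₂ (∈bag-descends R≼T (below i p≼d) v∈s (Vt-mono (child-≼ c∈p) v∈c))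
  ≼child⊎∈bag {p = node X cs} {s} R≼T (below i p≼d) (below j s≼d′) c∈p v∈s v∈c
    with ∈Vt-siblings R≼T i j (Vt-mono (≼-trans (child-≼ c∈p) p≼d) v∈c)
                              (Vt-mono s≼d′ (bag⊆Vt s v∈s))
  ... | inj₁ refl = ≼child⊎∈bag (≼-trans (child-≼ i) R≼T) p≼d s≼d′ c∈p v∈s v∈c
  ... | inj₂ v∈R  = inj₂ (∈bag-descends R≼T (below i p≼d) v∈R (Vt-mono (child-≼ c∈p) v∈c))

  common-bag : ∀ {a b} → arcO D a b ≡ true ⊎ arcO D b a ≡ true →
               ∃ λ s → s ≼ T × a ∈ bag s × b ∈ bag s
  common-bag {a} {b} (inj₁ ab) = edgeCover a b ab
  common-bag {a} {b} (inj₂ ba) with edgeCover b a ba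
  ... | s , s≼T , b∈s , a∈s = s , s≼T , a∈s , b∈s

  adjacent-separated : ∀ {X cs c a b} → node X cs ≼ T → c ∈ₗ cs → a ∈ Vt c →
                       arcO D a b ≡ true ⊎ arcO D b a ≡ true → a ∈ X ⊎ b ∈ Vt c
  adjacent-separated p≼T c∈p a∈c adj with common-bag adj
  ... | s , s≼T , a∈s , b∈s with ≼child⊎∈bag here p≼T s≼T c∈p a∈s a∈c
  ...   | inj₁ s≼c = inj₂ (Vt-mono s≼c (bag⊆Vt s b∈s))
  ...   | inj₂ a∈X = inj₁ a∈X

module _ {n : ℕ} where

  Adjacent : Digraph n → Rel (Fin n) 0ℓ
  Adjacent G u v = arc G u v ≡ true ⊎ arc G v u ≡ true

  ∈vtx-⊕⁺ : ∀ {k u} (G : Digraph n) (Ys : Vec (Subset n) k) → u ∈ vtx G → u ∈ vtx (G ⊕ Ys)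
  ∈vtx-⊕⁺ G []       u∈G = u∈G
  ∈vtx-⊕⁺ G (Y ∷ Ys) u∈G = ∈vtx-⊕⁺ (invert G Y) Ys u∈G

  ∈vtx-⊕⁻ : ∀ {k u} (G : Digraph n) (Ys : Vec (Subset n) k) → u ∈ vtx (G ⊕ Ys) → u ∈ vtx G
  ∈vtx-⊕⁻ G []       u∈G = u∈G
  ∈vtx-⊕⁻ G (Y ∷ Ys) u∈G = ∈vtx-⊕⁻ (invert G Y) Ys u∈G

  adjacent-invert : ∀ {u v} (G : Digraph n) (Y : Subset n) →
                    Adjacent (invert G Y) u v → Adjacent G u v
  adjacent-invert G Y = λ { (inj₁ uv) → reversed uv ; (inj₂ vu) → swap (reversed vu) }
    where
      reversed : ∀ {x y} → arc (invert G Y) x y ≡ true → Adjacent G x y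
      reversed {x} {y} e with lookup Y x ∧ lookup Y y
      ... | true  = inj₂ e
      ... | false = inj₁ e

  adjacent-⊕ : ∀ {k u v} (G : Digraph n) (Ys : Vec (Subset n) k) →
               Adjacent (G ⊕ Ys) u v → Adjacent G u v
  adjacent-⊕ G []       adj = adj
  adjacent-⊕ G (Y ∷ Ys) adj = adjacent-invert G Y (adjacent-⊕ (invert G Y) Ys adj)

  Agree : Subset n → Digraph n → Digraph n → Set
  Agree W G G′ = ∀ {u v} → u ∈ W → v ∈ W → arc G u v ≡ arc G′ u v

  lookup-∩-∈ : ∀ (Y W : Subset n) {u} → u ∈ W → lookup (Y ∩ W) u ≡ lookup Y u
  lookup-∩-∈ Y W {u} u∈W rewrite lookup-zipWith _∧_ u Y W | []=⇒lookup u∈W =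
    ∧-identityʳ (lookup Y u)

  Agree-invert : ∀ {W} (G G′ : Digraph n) (Y : Subset n) → Agree W G G′ →
                 Agree W (invert G Y) (invert G′ (Y ∩ W))
  Agree-invert {W} _ _ Y agree {u} {v} u∈W v∈W
    rewrite lookup-∩-∈ Y W u∈W | lookup-∩-∈ Y W v∈W with lookup Y u ∧ lookup Y v
  ... | true  = agree v∈W u∈W
  ... | false = agree u∈W v∈W

  Agree-⊕ : ∀ {k W} (G G′ : Digraph n) (Ys : Vec (Subset n) k) → Agree W G G′ →
            Agree W (G ⊕ Ys) (G′ ⊕ map (_∩ W) Ys)
  Agree-⊕ G G′ []       agree = agree
  Agree-⊕ G G′ (Y ∷ Ys) agree =
    Agree-⊕ (invert G Y) (invert G′ (Y ∩ _)) Ys (Agree-invert G G′ Y agree)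

  Reachable : Digraph n → Rel (Fin n) 0ℓ
  Reachable G u v = ∃ (Walk G u v)

  walk-head : ∀ {G : Digraph n} {u v vs} → Walk G u v vs → u ∈ vtx G
  walk-head (stop u∈G)     = u∈G
  walk-head (step u∈G _ _) = u∈G

  reachable-trans : ∀ {G : Digraph n} → Transitive (Reachable G)
  reachable-trans (_ , stop _)         q = q
  reachable-trans (_ , step u∈G e p) q with reachable-trans (_ , p) q
  ... | _ , pq = _ , step u∈G e pq

  walk-transport : ∀ {G G′ : Digraph n} {W u v vs} → vtx G ⊆ W → W ⊆ vtx G′ → Agree W G G′ →
                   Walk G u v vs → Walk G′ u v vs
  walk-transport G⊆W W⊆G′ agree (stop u∈G) = stop (W⊆G′ (G⊆W u∈G))
  walk-transport G⊆W W⊆G′ agree (step u∈G e p) =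
    step (W⊆G′ (G⊆W u∈G)) (trans (sym (agree (G⊆W u∈G) (G⊆W (walk-head p)))) e)
         (walk-transport G⊆W W⊆G′ agree p)

  open DecMembership (_≟_ {n}) using () renaming (_∈?_ to _∈ₗ?_)

  suffix-dirPath : ∀ {G : Digraph n} {u w v vs} → Walk G w v vs → u ∈ₗ vs → Unique vs → DirPath G u v
  suffix-dirPath (stop u∈G)     (here refl) uniq       = _ , stop u∈G , uniq
  suffix-dirPath (step u∈G e p) (here refl) uniq       = _ , step u∈G e p , uniq
  suffix-dirPath (step _ _ p)   (there i)   (_ ∷ uniq) = suffix-dirPath p i uniq

  walk⇒dirPath : ∀ {G : Digraph n} {u v vs} → Walk G u v vs → DirPath G u v
  walk⇒dirPath (stop u∈G) = _ , stop u∈G , [] ∷ []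
  walk⇒dirPath {u = u} (step u∈G e p) with walk⇒dirPath p
  ... | vs , q , uniq with u ∈ₗ? vs
  ...   | yes u∈q = suffix-dirPath q u∈q uniq
  ...   | no  u∉q = u ∷ vs , step u∈G e q , ¬Any⇒All¬ vs u∉q ∷ uniq

  dirPath⇔reachable : ∀ {G : Digraph n} {u v} → DirPath G u v ⇔ Reachable G u v
  dirPath⇔reachable = mk⇔ (λ (vs , p , _) → vs , p) (walk⇒dirPath ∘ proj₂)

module WalkSplitting {n} {I : Set} (G : Digraph n) (H : I → Digraph n) (X : Subset n)
  (overlap⊆X : ∀ {r r′ a} → a ∈ vtx (H r) → a ∈ vtx (H r′) → r ≡ r′ ⊎ a ∈ X)
  (arc-within-side : ∀ {a b} → a ∈ vtx G → b ∈ vtx G → arc G a b ≡ true →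
                     ∃ λ r → a ∈ vtx (H r) × b ∈ vtx (H r) × arc (H r) a b ≡ true)
  where

  Hop : Rel (Fin n) 0ℓ
  Hop x y = x ∈ X × y ∈ X × ∃ λ r → Reachable (H r) x y

  first-hop : ∀ {r a y vs} → a ∈ vtx (H r) → Walk G a y vs → y ∈ X →
              ∃ λ x → x ∈ X × Reachable (H r) a x × Star Hop x y
  first-hop a∈H (stop _) y∈X = _ , y∈X , (_ , stop a∈H) , ε
  first-hop a∈H (step a∈G e p) y∈X with arc-within-side a∈G (walk-head p) e
  ... | r′ , a∈H′ , b∈H′ , e′ with first-hop b∈H′ p y∈X | overlap⊆X a∈H a∈H′
  ...   | x , x∈X , (_ , q) , hops | inj₁ refl = x , x∈X , (_ , step a∈H e′ q) , hops
  ...   | x , x∈X , (_ , q) , hops | inj₂ a∈X =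
    _ , a∈X , (_ , stop a∈H) , (a∈X , x∈X , r′ , _ , step a∈H′ e′ q) ◅ hops

  walk⇒hops : ∀ r {x y vs} → x ∈ X → x ∈ vtx (H r) → Walk G x y vs → y ∈ X → Star Hop x y
  walk⇒hops _ x∈X x∈H p y∈X with first-hop x∈H p y∈X
  ... | x′ , x′∈X , q , hops = (x∈X , x′∈X , _ , q) ◅ hops

module JoinNode {n k} (D : OrientedGraph n) {T : Tree n} (td : IsTreeDecomposition D T)
  (X : Subset n) (t₁ t₂ : Tree n) (join≼T : node X (t₁ ∷ t₂ ∷ []) ≼ T)
  (bag₁ : bag t₁ ≡ X) (bag₂ : bag t₂ ≡ X) (Ŝ : Vec (Subset n) k)
  where
  open IsTreeDecomposition td using (connSibling)
  open TreeDecomposition td using (adjacent-separated)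

  V : Subset n
  V = Vt (node X (t₁ ∷ t₂ ∷ []))

  D̂ : Digraph n
  D̂ = (D [ V ]) ⊕ Ŝ

  child : Fin 2 → Tree n
  child zero       = t₁
  child (suc zero) = t₂

  D̂ᵣ : Fin 2 → Digraph n
  D̂ᵣ r = (D [ Vt (child r) ]) ⊕ map (_∩ Vt (child r)) Ŝ

  child∈ : ∀ r → child r ∈ₗ t₁ ∷ t₂ ∷ []
  child∈ zero       = here refl
  child∈ (suc zero) = there (here refl)

  X⊆Vt-child : ∀ r → X ⊆ Vt (child r)
  X⊆Vt-child zero       = subst (_⊆ Vt t₁) bag₁ (bag⊆Vt t₁)
  X⊆Vt-child (suc zero) = subst (_⊆ Vt t₂) bag₂ (bag⊆Vt t₂)

  Vt-child⊆V : ∀ r → Vt (child r) ⊆ V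
  Vt-child⊆V r = Vt-mono (child-≼ (child∈ r))

  V⊆Vt-children : ∀ {v} → v ∈ V → ∃ λ r → v ∈ Vt (child r)
  V⊆Vt-children v∈V with x∈p∪q⁻ X _ v∈V
  ... | inj₁ v∈X = zero , X⊆Vt-child zero v∈X
  ... | inj₂ v∈Vts with x∈p∪q⁻ (Vt t₁) _ v∈Vts
  ...   | inj₁ v∈t₁ = zero , v∈t₁
  ...   | inj₂ v∈t₂∪⊥ with x∈p∪q⁻ (Vt t₂) _ v∈t₂∪⊥
  ...     | inj₁ v∈t₂ = suc zero , v∈t₂
  ...     | inj₂ v∈⊥  = ⊥-elim (∉⊥ v∈⊥)

  D̂-agrees : ∀ r → Agree (Vt (child r)) D̂ (D̂ᵣ r)
  D̂-agrees r = Agree-⊕ (D [ V ]) (D [ Vt (child r) ]) Ŝ (λ _ _ → refl)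

  ∈D̂ᵣ⁺ : ∀ r {a} → a ∈ Vt (child r) → a ∈ vtx (D̂ᵣ r)
  ∈D̂ᵣ⁺ r = ∈vtx-⊕⁺ (D [ Vt (child r) ]) (map (_∩ Vt (child r)) Ŝ)

  ∈D̂ᵣ⁻ : ∀ r {a} → a ∈ vtx (D̂ᵣ r) → a ∈ Vt (child r)
  ∈D̂ᵣ⁻ r = ∈vtx-⊕⁻ (D [ Vt (child r) ]) (map (_∩ Vt (child r)) Ŝ)

  sides-overlap⊆X : ∀ {r r′ a} → a ∈ vtx (D̂ᵣ r) → a ∈ vtx (D̂ᵣ r′) → r ≡ r′ ⊎ a ∈ X
  sides-overlap⊆X {r} {r′} {a} a∈r a∈r′ = shared r r′ (∈D̂ᵣ⁻ r a∈r) (∈D̂ᵣ⁻ r′ a∈r′)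
    where
      shared : ∀ r r′ → a ∈ Vt (child r) → a ∈ Vt (child r′) → r ≡ r′ ⊎ a ∈ X
      shared zero       zero       _    _    = inj₁ refl
      shared zero       (suc zero) a∈t₁ a∈t₂ = inj₂ (connSibling X [] t₁ [] t₂ [] a join≼T a∈t₁ a∈t₂)
      shared (suc zero) zero       a∈t₂ a∈t₁ = inj₂ (connSibling X [] t₁ [] t₂ [] a join≼T a∈t₁ a∈t₂)
      shared (suc zero) (suc zero) _    _    = inj₁ refl

  adjacent-within-child : ∀ {a b} → a ∈ V → b ∈ V → Adjacent (D [ V ]) a b →
                          ∃ λ r → a ∈ Vt (child r) × b ∈ Vt (child r)
  adjacent-within-child a∈V b∈V adj with V⊆Vt-children a∈V
  ... | r , a∈r with adjacent-separated join≼T (child∈ r) a∈r adj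
  ...   | inj₂ b∈r = r , a∈r , b∈r
  ...   | inj₁ a∈X with V⊆Vt-children b∈V
  ...     | r′ , b∈r′ = r′ , X⊆Vt-child r′ a∈X , b∈r′

  arc-within-side : ∀ {a b} → a ∈ vtx D̂ → b ∈ vtx D̂ → arc D̂ a b ≡ true →
                    ∃ λ r → a ∈ vtx (D̂ᵣ r) × b ∈ vtx (D̂ᵣ r) × arc (D̂ᵣ r) a b ≡ true
  arc-within-side a∈D̂ b∈D̂ e
    with adjacent-within-child (∈vtx-⊕⁻ (D [ V ]) Ŝ a∈D̂) (∈vtx-⊕⁻ (D [ V ]) Ŝ b∈D̂)
                               (adjacent-⊕ (D [ V ]) Ŝ (inj₁ e))
  ... | r , a∈r , b∈r = r , ∈D̂ᵣ⁺ r a∈r , ∈D̂ᵣ⁺ r b∈r , trans (sym (D̂-agrees r a∈r b∈r)) e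

  side⇒D̂ : ∀ r {x y} → Reachable (D̂ᵣ r) x y → Reachable D̂ x y
  side⇒D̂ r (vs , p) =
    vs , walk-transport (∈D̂ᵣ⁻ r) (∈vtx-⊕⁺ (D [ V ]) Ŝ ∘ Vt-child⊆V r)
                        (λ u∈r v∈r → sym (D̂-agrees r u∈r v∈r)) p

  module _ (Q₁ Q₂ : Rel (Fin n) 0ℓ) (Q₁⊆X : Q₁ ⊆P X) (Q₂⊆X : Q₂ ⊆P X)
    (h₁ : ∀ u v → InP X u v → DirPath (D̂ᵣ zero) u v ⇔ Q₁ u v)
    (h₂ : ∀ u v → InP X u v → DirPath (D̂ᵣ (suc zero)) u v ⇔ Q₂ u v)
    where
    open WalkSplitting D̂ D̂ᵣ X sides-overlap⊆X arc-within-side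

    reachable₁⇔Q₁ : ∀ {x y} → InP X x y → Reachable (D̂ᵣ zero) x y ⇔ Q₁ x y
    reachable₁⇔Q₁ xy∈P = ⇔-trans (⇔-sym dirPath⇔reachable) (h₁ _ _ xy∈P)

    reachable₂⇔Q₂ : ∀ {x y} → InP X x y → Reachable (D̂ᵣ (suc zero)) x y ⇔ Q₂ x y
    reachable₂⇔Q₂ xy∈P = ⇔-trans (⇔-sym dirPath⇔reachable) (h₂ _ _ xy∈P)

    side⇒Q : ∀ r {x y} → InP X x y → Reachable (D̂ᵣ r) x y → (Q₁ ∪ Q₂) x y
    side⇒Q zero       xy∈P = inj₁ ∘ Equivalence.to (reachable₁⇔Q₁ xy∈P)
    side⇒Q (suc zero) xy∈P = inj₂ ∘ Equivalence.to (reachable₂⇔Q₂ xy∈P)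

    Q⇒D̂ : (Q₁ ∪ Q₂) ⇒ Reachable D̂
    Q⇒D̂ (inj₁ q) = side⇒D̂ zero       (Equivalence.from (reachable₁⇔Q₁ (Q₁⊆X _ _ q)) q)
    Q⇒D̂ (inj₂ q) = side⇒D̂ (suc zero) (Equivalence.from (reachable₂⇔Q₂ (Q₂⊆X _ _ q)) q)

    hop⇒Q⋆ : Hop ⇒ Star (Q₁ ∪ Q₂)
    hop⇒Q⋆ {x} {y} (x∈X , y∈X , r , p) with x ≟ y
    ... | yes refl = ε
    ... | no  x≢y  = side⇒Q r (x∈X , y∈X , x≢y) p ◅ ε

    reachable⇔TC : ∀ {u v} → InP X u v → Reachable D̂ u v ⇔ TransClosure (Q₁ ∪ Q₂) u v
    reachable⇔TC (u∈X , v∈X , u≢v) = mk⇔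
      (λ (_ , p) → star⇒⁺ ((hop⇒Q⋆ ⋆) (walk⇒hops zero u∈X u∈D̂₁ p v∈X)) u≢v)
      (fold⁺ reachable-trans Q⇒D̂)
      where u∈D̂₁ = ∈D̂ᵣ⁺ zero (X⊆Vt-child zero u∈X)

lemma13 : ∀ {n k} (D : OrientedGraph n) (T : Tree n) →
    IsNiceTreeDecomposition D T →
    (X : Subset n) (t₁ t₂ : Tree n) →
    node X (t₁ ∷ t₂ ∷ []) ≼ T → bag t₁ ≡ X → bag t₂ ≡ X →
    (Q₁ Q₂ : Rel (Fin n) 0ℓ) → Q₁ ⊆P X → Q₂ ⊆P X →
    (S Ŝ : Vec (Subset n) k) →
    (∀ i → lookup S i ⊆ X) →
    (∀ i → lookup Ŝ i ⊆ Vt (node X (t₁ ∷ t₂ ∷ []))) →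
    (∀ i → lookup Ŝ i ∩ X ≡ lookup S i) →
    (∀ u v → InP X u v →
      DirPath ((D [ Vt t₁ ]) ⊕ map (_∩ Vt t₁) Ŝ) u v ⇔ Q₁ u v) →
    (∀ u v → InP X u v →
      DirPath ((D [ Vt t₂ ]) ⊕ map (_∩ Vt t₂) Ŝ) u v ⇔ Q₂ u v) →
    ∀ u v → InP X u v →
      DirPath ((D [ Vt (node X (t₁ ∷ t₂ ∷ [])) ]) ⊕ Ŝ) u v ⇔ TransClosure (Q₁ ∪ Q₂) u v
lemma13 D T ntd X t₁ t₂ join≼T bag₁ bag₂ Q₁ Q₂ Q₁⊆X Q₂⊆X _ Ŝ _ _ _ h₁ h₂ u v uv∈P =
  ⇔-trans dirPath⇔reachable (reachable⇔TC Q₁ Q₂ Q₁⊆X Q₂⊆X h₁ h₂ uv∈P)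
  where open JoinNode D (IsNiceTreeDecomposition.isTD ntd) X t₁ t₂ join≼T bag₁ bag₂ Ŝ
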